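{- Let $f:S\to T$ be an se-homomorphism between semigroups with apartness. Then: (i) $\mathrm{coker}\,f$ is a co-congruence on $S$; (ii) $\mathrm{coker}\,f\looparrowleft\ker f$ and $\ker f\subseteq(\mathrm{coker}\,f)^c$; (iii) $(S/\ker f,=,\#,\cdot)$ is a semigroup with apartness, where $a(\ker f)=b(\ker f)\iff(a,b)\in\ker f$, $a(\ker f)\#b(\ker f)\iff(a,b)\in\mathrm{coker}\,f$, and $a(\ker f)\cdot b(\ker f)=(ab)(\ker f)$; (iv) the mapping $\varphi:S/\ker f\to T$, $\varphi(x(\ker f))=f(x)$, is an apartness embedding with $f=\varphi\pi$, where $\pi(x)=x(\ker f)$; (v) if $f$ maps $S$ onto $T$, then $\varphi$ is an apartness isomorphism.
   Context: Constructive (Bishop-style) setting. A set with apartness: inhabited set with equality $=$ (an equivalence) and $\#$ with $\neg(x\#x)$, $x\#y\Rightarrow y\#x$, $x\#z\Rightarrow\forall y(x\#y\vee y\#z)$, extensional w.r.t. $=$; $S\times S$ has apartness $(s,t)\#(u,v)\iff s\#u\vee t\#v$. A semigroup with apartness is a set with apartness with an associative operation satisfying $ax\#by\Rightarrow(a\#b\vee x\#y)$. An se-homomorphism is a homomorphism $f$ with $f(x)\#f(y)\Rightarrow x\#y$; $f$ is a-injective if $x\#y\Rightarrow f(x)\#f(y)$. An apartness embedding is an a-injective injective se-homomorphism; an apartness isomorphism is an a-injective bijective se-homomorphism. $\ker f=\{(x,y):f(x)=f(y)\}$, $\mathrm{coker}\,f=\{(x,y):f(x)\#f(y)\}$. A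 co-congruence is a relation $\kappa$ that is symmetric, strongly irreflexive ($(x,y)\in\kappa\Rightarrow x\#y$), co-transitive ($(x,y)\in\kappa\Rightarrow\forall z((x,z)\in\kappa\vee(z,y)\in\kappa)$) and co-compatible ($(xz,yt)\in\kappa\Rightarrow(x,y)\in\kappa\vee(z,t)\in\kappa$). For such $\kappa$, $\kappa^c=\{(x,y):\forall(a,b)\in\kappa\,((x,y)\#(a,b))\}$. $\alpha\looparrowleft\beta$ means $(x,y)\in\alpha\wedge(y,z)\in\beta\Rightarrow(x,z)\in\alpha$. -}

module Defs where

open import Level using (Level; _⊔_; suc)
open import Data.Product using (Σ; ∃; _×_; _,_)
open import Data.Sum using (_⊎_)
open import Relation.Nullary using (¬_)
open import Relation.Binary.Core using (Rel)
open import Relation.Binary.Structures using (IsEquivalence)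

private variable a b ℓ ℓ' ℓ₁ ℓ₁' : Level

record IsSetWithApartness {A : Set a} (_≈_ : Rel A ℓ) (_#_ : Rel A ℓ') : Set (a ⊔ ℓ ⊔ ℓ') where
  field
    inhabitant  : A
    isEquivalence : IsEquivalence _≈_
    #-irrefl    : ∀ {x} → ¬ (x # x)
    #-sym       : ∀ {x y} → x # y → y # x
    #-cotrans   : ∀ {x z} → x # z → ∀ y → (x # y) ⊎ (y # z)
    #-ext       : ∀ {x y x' y'} → x ≈ x' → y ≈ y' → x # y → x' # y'

record IsSemigroupWithApartness {A : Set a} (_≈_ : Rel A ℓ) (_#_ : Rel A ℓ') (_∙_ : A → A → A)
       : Set (a ⊔ ℓ ⊔ ℓ') where
  field
    isSetWithApartness : IsSetWithApartness _≈_ _#_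
    ∙-cong   : ∀ {x y u v} → x ≈ y → u ≈ v → (x ∙ u) ≈ (y ∙ v)
    assoc    : ∀ x y z → ((x ∙ y) ∙ z) ≈ (x ∙ (y ∙ z))
    ∙-sext   : ∀ {a b x y} → (a ∙ x) # (b ∙ y) → (a # b) ⊎ (x # y)
  open IsSetWithApartness isSetWithApartness public

record SemigroupWithApartness a ℓ ℓ' : Set (suc (a ⊔ ℓ ⊔ ℓ')) where
  infix 4 _≈_ _#_
  infixl 7 _∙_
  field
    Carrier : Set a
    _≈_ : Rel Carrier ℓ
    _#_ : Rel Carrier ℓ'
    _∙_ : Carrier → Carrier → Carrier
    isSemigroupWithApartness : IsSemigroupWithApartness _≈_ _#_ _∙_
  open IsSemigroupWithApartness isSemigroupWithApartness public

module _ (S : SemigroupWithApartness a ℓ ℓ') (T : SemigroupWithApartness b ℓ₁ ℓ₁') where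
  private
    module S = SemigroupWithApartness S
    module T = SemigroupWithApartness T

  record IsHomomorphism (f : S.Carrier → T.Carrier) : Set (a ⊔ ℓ ⊔ ℓ₁) where
    field
      cong    : ∀ {x y} → x S.≈ y → f x T.≈ f y
      homo    : ∀ x y → f (x S.∙ y) T.≈ (f x T.∙ f y)

  record IsSeHomomorphism (f : S.Carrier → T.Carrier) : Set (a ⊔ ℓ ⊔ ℓ' ⊔ ℓ₁ ⊔ ℓ₁') where
    field
      isHomomorphism : IsHomomorphism f
      sext : ∀ {x y} → f x T.# f y → x S.# y
    open IsHomomorphism isHomomorphism public

  AInjective : (S.Carrier → T.Carrier) → Set (a ⊔ ℓ' ⊔ ℓ₁')
  AInjective f = ∀ {x y} → x S.# y → f x T.# f y

  Injective : (S.Carrier → T.Carrier) → Set (a ⊔ ℓ ⊔ ℓ₁)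
  Injective f = ∀ {x y} → f x T.≈ f y → x S.≈ y

  Surjective : (S.Carrier → T.Carrier) → Set (a ⊔ b ⊔ ℓ₁)
  Surjective f = ∀ t → ∃ λ s → f s T.≈ t

  IsApartnessEmbedding : (S.Carrier → T.Carrier) → Set (a ⊔ ℓ ⊔ ℓ' ⊔ ℓ₁ ⊔ ℓ₁')
  IsApartnessEmbedding f = IsSeHomomorphism f × AInjective f × Injective f

  IsApartnessIsomorphism : (S.Carrier → T.Carrier) → Set (a ⊔ b ⊔ ℓ ⊔ ℓ' ⊔ ℓ₁ ⊔ ℓ₁')
  IsApartnessIsomorphism f = IsSeHomomorphism f × AInjective f × (Injective f × Surjective f)

  ker : (S.Carrier → T.Carrier) → Rel S.Carrier ℓ₁
  ker f x y = f x T.≈ f y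

  coker : (S.Carrier → T.Carrier) → Rel S.Carrier ℓ₁'
  coker f x y = f x T.# f y

module _ (S : SemigroupWithApartness a ℓ ℓ') where
  private module S = SemigroupWithApartness S

  record IsCoCongruence {ℓκ} (κ : Rel S.Carrier ℓκ) : Set (a ⊔ ℓ' ⊔ ℓκ) where
    field
      sym          : ∀ {x y} → κ x y → κ y x
      strongIrrefl : ∀ {x y} → κ x y → x S.# y
      cotrans      : ∀ {x y} → κ x y → ∀ z → κ x z ⊎ κ z y
      cocompatible : ∀ {x y z t} → κ (x S.∙ z) (y S.∙ t) → κ x y ⊎ κ z t

  -- κ^c = {(x,y) : ∀ (a,b) ∈ κ, (x,y) # (a,b)}, with (x,y)#(a,b) ⇔ x#a ∨ y#b
  _ᶜ : ∀ {ℓκ} → Rel S.Carrier ℓκ → Rel S.Carrier (a ⊔ ℓ' ⊔ ℓκ)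
  (κ ᶜ) x y = ∀ u v → κ u v → (x S.# u) ⊎ (y S.# v)

_↬_ : ∀ {A : Set a} {ℓα ℓβ} → Rel A ℓα → Rel A ℓβ → Set (a ⊔ ℓα ⊔ ℓβ)
α ↬ β = ∀ {x y z} → α x y → β y z → α x z

_⊆₂_ : ∀ {A : Set a} {ℓα ℓβ} → Rel A ℓα → Rel A ℓβ → Set (a ⊔ ℓα ⊔ ℓβ)
α ⊆₂ β = ∀ {x y} → α x y → β x y

Quot : (S : SemigroupWithApartness a ℓ ℓ') (T : SemigroupWithApartness b ℓ₁ ℓ₁')
       (f : SemigroupWithApartness.Carrier S → SemigroupWithApartness.Carrier T) →
       IsSemigroupWithApartness (ker S T f) (coker S T f) (SemigroupWithApartness._∙_ S) →
       SemigroupWithApartness a ℓ₁ ℓ₁'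
Quot S T f isQ = record
  { Carrier = SemigroupWithApartness.Carrier S
  ; _≈_ = ker S T f
  ; _#_ = coker S T f
  ; _∙_ = SemigroupWithApartness._∙_ S
  ; isSemigroupWithApartness = isQ }

{-# OPTIONS --safe #-}
-- The quotient S/ker f carries exactly the equality and apartness of T pulled back
-- along f, so φ is f itself on the same carrier: each clause reduces to an axiom of T
-- (cotransitivity, extensionality, strong extensionality of ·) transported by f,
-- with the se-property of f bringing apartness back to S.
module Submission where

open import Defs
open import Level using (Level)
open import Data.Product using (Σ; _×_; _,_)
open import Data.Sum as Sum using (_⊎_)
open import Function using (_on_; _∘_; id)
open import Relation.Binary.Core using (Rel)
open import Relation.Binary.Bundles using (Setoid)
open import Relation.Binary.Structures using (IsEquivalence)
import Relation.Binary.Construct.On as On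

private variable a b ℓ ℓ' ℓ₁ ℓ₁' : Level

IsSetWithApartness-on : ∀ {A : Set a} {B : Set b} {_≈_ : Rel B ℓ} {_#_ : Rel B ℓ'} →
  IsSetWithApartness _≈_ _#_ → (f : A → B) → A →
  IsSetWithApartness (_≈_ on f) (_#_ on f)
IsSetWithApartness-on isB f x = record
  { inhabitant    = x
  ; isEquivalence = On.isEquivalence f B.isEquivalence
  ; #-irrefl      = B.#-irrefl
  ; #-sym         = B.#-sym
  ; #-cotrans     = λ p y → B.#-cotrans p (f y)
  ; #-ext         = B.#-ext
  }
  where module B = IsSetWithApartness isB

module _ (S : SemigroupWithApartness a ℓ ℓ') (T : SemigroupWithApartness b ℓ₁ ℓ₁') where
  private
    module S = SemigroupWithApartness S
    module T = SemigroupWithApartness T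

    T-setoid : Setoid b ℓ₁
    T-setoid = record { isEquivalence = T.isEquivalence }

    module T≈ = Setoid T-setoid

  coker↬ker : (f : S.Carrier → T.Carrier) → coker S T f ↬ ker S T f
  coker↬ker f fx#fy fy≈fz = T.#-ext T≈.refl fy≈fz fx#fy

  module _ {f : S.Carrier → T.Carrier} where

    coker-∙-sext : IsHomomorphism S T f →
      ∀ {x y z t} → coker S T f (x S.∙ z) (y S.∙ t) → coker S T f x y ⊎ coker S T f z t
    coker-∙-sext hom {x} {y} {z} {t} p = T.∙-sext (T.#-ext (homo x z) (homo y t) p)
      where open IsHomomorphism hom

    coker-isCoCongruence : IsSeHomomorphism S T f → IsCoCongruence S (coker S T f)
    coker-isCoCongruence se = record
      { sym          = T.#-sym
      ; strongIrrefl = sext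
      ; cotrans      = λ p z → T.#-cotrans p (f z)
      ; cocompatible = coker-∙-sext isHomomorphism
      }
      where open IsSeHomomorphism se

    ker⊆coker-ᶜ : IsSeHomomorphism S T f → ker S T f ⊆₂ _ᶜ S (coker S T f)
    ker⊆coker-ᶜ se {x} fx≈fy u v fu#fv =
      Sum.map (S.#-sym ∘ sext) (sext ∘ T.#-ext fx≈fy T≈.refl) (T.#-cotrans fu#fv (f x))
      where open IsSeHomomorphism se

    quotient-isSemigroupWithApartness : IsHomomorphism S T f →
      IsSemigroupWithApartness (ker S T f) (coker S T f) S._∙_
    quotient-isSemigroupWithApartness hom = record
      { isSetWithApartness = IsSetWithApartness-on T.isSetWithApartness f S.inhabitant
      ; ∙-cong             = λ {x} {y} {u} {v} fx≈fy fu≈fv → begin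
          f (x S.∙ u)   ≈⟨ homo x u ⟩
          f x T.∙ f u   ≈⟨ T.∙-cong fx≈fy fu≈fv ⟩
          f y T.∙ f v   ≈⟨ homo y v ⟨
          f (y S.∙ v)   ∎
      ; assoc              = λ x y z → cong (S.assoc x y z)
      ; ∙-sext             = coker-∙-sext hom
      }
      where
      open IsHomomorphism hom
      open import Relation.Binary.Reasoning.Setoid T-setoid

    factor-isSeHomomorphism : (hom : IsHomomorphism S T f) →
      IsSeHomomorphism (Quot S T f (quotient-isSemigroupWithApartness hom)) T f
    factor-isSeHomomorphism hom = record
      { isHomomorphism = record { cong = id ; homo = IsHomomorphism.homo hom }
      ; sext           = id
      }

    factor-isApartnessEmbedding : (hom : IsHomomorphism S T f) →
      IsApartnessEmbedding (Quot S T f (quotient-isSemigroupWithApartness hom)) T f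
    factor-isApartnessEmbedding hom = factor-isSeHomomorphism hom , id , id

    factor-isApartnessIsomorphism : (hom : IsHomomorphism S T f) → Surjective S T f →
      IsApartnessIsomorphism (Quot S T f (quotient-isSemigroupWithApartness hom)) T f
    factor-isApartnessIsomorphism hom surj = factor-isSeHomomorphism hom , id , id , surj

theorem22 : ∀ {a b ℓ ℓ' ℓ₁ ℓ₁' : Level}
    (S : SemigroupWithApartness a ℓ ℓ') (T : SemigroupWithApartness b ℓ₁ ℓ₁')
    (f : SemigroupWithApartness.Carrier S → SemigroupWithApartness.Carrier T) →
    IsSeHomomorphism S T f →
    -- (i)
    IsCoCongruence S (coker S T f)
    -- (ii)
    × (coker S T f ↬ ker S T f)
    × (ker S T f ⊆₂ _ᶜ S (coker S T f))
    -- (iii), (iv), (v)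
    × Σ (IsSemigroupWithApartness (ker S T f) (coker S T f) (SemigroupWithApartness._∙_ S))
        (λ isQ →
          -- φ (x ker f) = f x ; π x = x ker f
          IsApartnessEmbedding (Quot S T f isQ) T f
          -- f = φ ∘ π  (φ and π are the identity on underlying carriers)
          × (∀ x → SemigroupWithApartness._≈_ T (f x) (f x))
          × (Surjective S T f → IsApartnessIsomorphism (Quot S T f isQ) T f))
theorem22 S T f se =
    coker-isCoCongruence S T se
  , coker↬ker S T f
  , ker⊆coker-ᶜ S T se
  , quotient-isSemigroupWithApartness S T hom
  , factor-isApartnessEmbedding S T hom
  , (λ x → IsEquivalence.refl (SemigroupWithApartness.isEquivalence T))
  , factor-isApartnessIsomorphism S T hom
  where
  hom : IsHomomorphism S T f
  hom = IsSeHomomorphism.isHomomorphism se
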